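{- If $D$ is a $2$-acyclic multidigraph, then its tree conflict graph $G^{\mathbf{t}}_D$ is chordal.
   Context: A multidigraph $D$ consists of finite sets $V(D)$, $E(D)$ and maps $s,t:E(D)\to V(D)$ (source, target). A directed cycle is a connected multidigraph without parallel edges (two distinct edges with the same source and same target) in which every vertex has in-degree and out-degree $1$; its length is its number of vertices. $D$ is $2$-acyclic if it contains no directed cycle of length at least $3$ (directed $2$-cycles are allowed). The tree conflict graph $G^{\mathbf{t}}_D$ is the simple graph with vertex set $E(D)$ in which distinct $e,f$ are adjacent iff $t(e)=t(f)$ or $\{s(e),t(e)\}=\{s(f),t(f)\}$. A graph is chordal if it has no induced cycle of length $\ge 4$. -}

module Defs where

open import Data.Nat using (ℕ; suc; _≤_)
open import Data.Nat.DivMod using (_mod_)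
open import Data.Fin using (Fin; toℕ)
open import Data.Product using (Σ; _×_)
open import Data.Sum using (_⊎_)
open import Relation.Binary.PropositionalEquality using (_≡_; _≢_)
open import Relation.Nullary using (¬_)
open import Function.Definitions using (Injective)
open import Function.Bundles using (_⇔_)

record Multidigraph : Set where
  field
    nV : ℕ
    nE : ℕ
    s  : Fin nE → Fin nV
    t  : Fin nE → Fin nV
open Multidigraph public

next : ∀ {k} → Fin k → Fin k
next {suc k} i = suc (toℕ i) mod (suc k)

record DirectedCycle (D : Multidigraph) (k : ℕ) : Set where
  field
    v      : Fin k → Fin (nV D)
    v-inj  : Injective _≡_ _≡_ v
    e      : Fin k → Fin (nE D)
    e-src  : ∀ i → s D (e i) ≡ v i
    e-tgt  : ∀ i → t D (e i) ≡ v (next i)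

TwoAcyclic : Multidigraph → Set
TwoAcyclic D = ∀ k → 3 ≤ k → ¬ DirectedCycle D k

record SimpleGraph : Set₁ where
  field
    n     : ℕ
    Adj   : Fin n → Fin n → Set
    irrefl : ∀ x → ¬ Adj x x
    sym    : ∀ {x y} → Adj x y → Adj y x
open SimpleGraph public

TCAdj : (D : Multidigraph) → Fin (nE D) → Fin (nE D) → Set
TCAdj D e f =
  e ≢ f × ( t D e ≡ t D f
          ⊎ ((s D e ≡ s D f × t D e ≡ t D f) ⊎ (s D e ≡ t D f × t D e ≡ s D f)))

treeConflictGraph : Multidigraph → SimpleGraph
treeConflictGraph D = record
  { n = nE D
  ; Adj = TCAdj D
  ; irrefl = λ x p → Data.Product.proj₁ p _≡_.refl
  ; sym = λ { (ne , Data.Sum.inj₁ p) → (λ q → ne (Relation.Binary.PropositionalEquality.sym q)) , Data.Sum.inj₁ (Relation.Binary.PropositionalEquality.sym p)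
            ; (ne , Data.Sum.inj₂ (Data.Sum.inj₁ (p , q))) → (λ r → ne (Relation.Binary.PropositionalEquality.sym r)) , Data.Sum.inj₂ (Data.Sum.inj₁ (Relation.Binary.PropositionalEquality.sym p , Relation.Binary.PropositionalEquality.sym q))
            ; (ne , Data.Sum.inj₂ (Data.Sum.inj₂ (p , q))) → (λ r → ne (Relation.Binary.PropositionalEquality.sym r)) , Data.Sum.inj₂ (Data.Sum.inj₂ (Relation.Binary.PropositionalEquality.sym q , Relation.Binary.PropositionalEquality.sym p)) }
  }
  where open Data.Product using (_,_)

CycAdj : ∀ {k} → Fin k → Fin k → Set
CycAdj i j = j ≡ next i ⊎ i ≡ next j

record InducedCycle (G : SimpleGraph) (k : ℕ) : Set where
  field
    c      : Fin k → Fin (n G)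
    c-inj  : Injective _≡_ _≡_ c
    c-adj  : ∀ i j → i ≢ j → (Adj G (c i) (c j) ⇔ CycAdj i j)

Chordal : SimpleGraph → Set
Chordal G = ∀ k → 4 ≤ k → ¬ InducedCycle G k

{-# OPTIONS --safe #-}
-- Read an induced cycle e₀ … e_{K-1} (K ≥ 4) of G^t_D as a K-periodic sequence. Consecutive
-- edges share their target or are antiparallel, and two consecutive steps of the same kind would
-- make eₓ and eₓ₊₂ adjacent, so the two kinds alternate. Hence K is even, K = 2M, and if e_r and
-- e_{r+1} share their target, the common targets hⱼ of e_{2j+r} and e_{2j+r+1} are pairwise
-- distinct (edges with a common target are adjacent, but positions of equal parity are never
-- consecutive on an even cycle). As e_{2j+r+1} and e_{2j+r+2} are antiparallel, e_{2j+r+2} runs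
-- from hⱼ to hⱼ₊₁, giving a directed cycle h₀ → … → h_{M-1} → h₀ of length M. The case M = 2 is
-- ruled out separately: then e_{r+1} and e_{r+3} are antiparallel, hence adjacent.
module Submission where

open import Defs hiding (sym)
open import Data.Nat using (ℕ; zero; suc; _+_; _*_; _≤_; _<_; z≤n; s≤s; NonZero; >-nonZero; _≟_; parity)
open import Data.Nat.Properties
  using (+-assoc; +-comm; +-suc; +-cancelˡ-≡; +-cancelʳ-≡; *-cancelʳ-≡; *-distribʳ-+; *-monoˡ-≤; +-mono-≤;
         ≤-trans; ≤-reflexive; <⇒≱)
open import Data.Nat.DivMod
  using (_%_; _/_; _mod_; m≡m%n+[m/n]*n; m%n<n; m%n%n≡m%n; %-distribˡ-+; %-remove-+ˡ; m<n⇒m%n≡m)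
open import Data.Nat.Divisibility using (_∣_; ∣-refl; n∣m*n; ∣m+n∣m⇒∣n; ∣⇒≤)
open import Data.Parity.Base using (0ℙ) renaming (_+_ to _⊕_; _*_ to _⊛_)
open import Data.Parity.Properties using (+-homo-+; *-homo-*; suc-homo-⁻¹; p≢p⁻¹; *-zeroʳ; +-identityʳ)
open import Data.Fin using (Fin; toℕ)
open import Data.Fin.Properties using (toℕ-injective; toℕ-fromℕ<; fromℕ<-cong; fromℕ<-injective; toℕ<n)
open import Data.Product using (_×_; _,_; proj₁; proj₂; ∃-syntax)
open import Data.Sum using (_⊎_; inj₁; inj₂)
open import Data.Empty using (⊥-elim)
open import Relation.Nullary using (¬_)
open import Relation.Nullary.Decidable using (decidable-stable)
open import Relation.Binary.PropositionalEquality using (_≡_; _≢_; refl; sym; trans; cong; subst; module ≡-Reasoning)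
open import Function.Bundles using (Equivalence)

even-or-odd : ∀ n → ∃[ m ] (n ≡ m * 2 ⊎ n ≡ suc (m * 2))
even-or-odd zero = 0 , inj₁ refl
even-or-odd (suc n) with even-or-odd n
... | m , inj₁ refl = m , inj₂ refl
... | m , inj₂ refl = suc m , inj₁ refl

parity-*2 : ∀ m → parity (m * 2) ≡ 0ℙ
parity-*2 zero = refl
parity-*2 (suc m) = parity-*2 m

parity-*2+ : ∀ m r → parity (m * 2 + r) ≡ parity r
parity-*2+ m r = trans (+-homo-+ (m * 2) r) (cong (_⊕ parity r) (parity-*2 m))

parity-suc-≢ : ∀ n → parity (suc n) ≢ parity n
parity-suc-≢ n eq = p≢p⁻¹ (parity (suc n)) (trans eq (sym (suc-homo-⁻¹ n)))

parity-% : ∀ n d .{{_ : NonZero d}} → parity d ≡ 0ℙ → parity (n % d) ≡ parity n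
parity-% n d even = begin
  parity (n % d)                               ≡⟨ sym (+-identityʳ _) ⟩
  parity (n % d) ⊕ 0ℙ                          ≡⟨ cong (parity (n % d) ⊕_) (sym (*-zeroʳ (parity (n / d)))) ⟩
  parity (n % d) ⊕ (parity (n / d) ⊛ 0ℙ)       ≡⟨ cong (λ p → parity (n % d) ⊕ (parity (n / d) ⊛ p)) (sym even) ⟩
  parity (n % d) ⊕ (parity (n / d) ⊛ parity d) ≡⟨ cong (parity (n % d) ⊕_) (sym (*-homo-* (n / d) d)) ⟩
  parity (n % d) ⊕ parity (n / d * d)          ≡⟨ sym (+-homo-+ (n % d) (n / d * d)) ⟩
  parity (n % d + n / d * d)                   ≡⟨ cong parity (sym (m≡m%n+[m/n]*n n d)) ⟩
  parity n                                     ∎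
  where open ≡-Reasoning

*2+-< : ∀ {m n r} → r ≤ 1 → m < n → m * 2 + r < n * 2
*2+-< {n = suc n} r≤1 (s≤s m≤n) =
  s≤s (≤-trans (+-mono-≤ (*-monoˡ-≤ 2 m≤n) r≤1) (≤-reflexive (+-comm (n * 2) 1)))

*2+-injective : ∀ {m n} r → m * 2 + r ≡ n * 2 + r → m ≡ n
*2+-injective {m} {n} r eq = *-cancelʳ-≡ m n 2 (+-cancelʳ-≡ r (m * 2) (n * 2) eq)

[m+n]%d≡n%d⇒d∣m : ∀ m n d .{{_ : NonZero d}} → (m + n) % d ≡ n % d → d ∣ m
[m+n]%d≡n%d⇒d∣m m n d eq = ∣m+n∣m⇒∣n (subst (d ∣_) (sym shifted) (n∣m*n ((m + n) / d))) (n∣m*n (n / d))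
  where
  open ≡-Reasoning
  shifted : n / d * d + m ≡ (m + n) / d * d
  shifted = +-cancelˡ-≡ (n % d) _ _ (begin
    n % d + (n / d * d + m)       ≡⟨ sym (+-assoc (n % d) (n / d * d) m) ⟩
    n % d + n / d * d + m         ≡⟨ cong (_+ m) (sym (m≡m%n+[m/n]*n n d)) ⟩
    n + m                         ≡⟨ +-comm n m ⟩
    m + n                         ≡⟨ m≡m%n+[m/n]*n (m + n) d ⟩
    (m + n) % d + (m + n) / d * d ≡⟨ cong (_+ (m + n) / d * d) eq ⟩
    n % d + (m + n) / d * d       ∎)

periodic-% : ∀ {A : Set} (f : ℕ → A) {n} .{{_ : NonZero n}} →
             (∀ x → f (n + x) ≡ f x) → ∀ x → f (x % n) ≡ f x
periodic-% f {n} periodic x = begin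
  f (x % n)               ≡⟨ sym (periodic-* (x / n) (x % n)) ⟩
  f (x / n * n + x % n)   ≡⟨ cong f (+-comm (x / n * n) (x % n)) ⟩
  f (x % n + x / n * n)   ≡⟨ cong f (sym (m≡m%n+[m/n]*n x n)) ⟩
  f x                     ∎
  where
  open ≡-Reasoning
  periodic-* : ∀ q y → f (q * n + y) ≡ f y
  periodic-* zero y = refl
  periodic-* (suc q) y = trans (cong f (+-assoc n (q * n) y)) (trans (periodic (q * n + y)) (periodic-* q y))

module _ {n : ℕ} .{{_ : NonZero n}} where

  mod-cong : ∀ x y → x % n ≡ y % n → x mod n ≡ y mod n
  mod-cong x y eq = fromℕ<-cong (x % n) (y % n) eq _ _

  mod-injective : ∀ x y → x mod n ≡ y mod n → x % n ≡ y % n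
  mod-injective x y = fromℕ<-injective (x % n) (y % n) _ _

  mod-periodic : ∀ x → (n + x) mod n ≡ x mod n
  mod-periodic x = mod-cong (n + x) x (%-remove-+ˡ x ∣-refl)

  mod-injective-< : ∀ {x y} → x < n → y < n → x mod n ≡ y mod n → x ≡ y
  mod-injective-< {x} {y} x<n y<n eq =
    trans (sym (m<n⇒m%n≡m x<n)) (trans (mod-injective x y eq) (m<n⇒m%n≡m y<n))

  mod-shift-≢ : ∀ {j} x → 0 < j → j < n → (j + x) mod n ≢ x mod n
  mod-shift-≢ {j} x 0<j j<n eq =
    <⇒≱ j<n (∣⇒≤ {{>-nonZero 0<j}} ([m+n]%d≡n%d⇒d∣m j x n (mod-injective (j + x) x eq)))

  mod-parity : parity n ≡ 0ℙ → ∀ x y → x mod n ≡ y mod n → parity x ≡ parity y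
  mod-parity even x y eq =
    trans (sym (parity-% x n even)) (trans (cong parity (mod-injective x y eq)) (parity-% y n even))

next-mod : ∀ {k} x → next (x mod suc k) ≡ suc x mod suc k
next-mod {k} x = mod-cong (suc (toℕ (x mod suc k))) (suc x) (begin
  suc (toℕ (x mod K)) % K    ≡⟨ cong (λ y → suc y % K) (toℕ-fromℕ< _) ⟩
  (1 + x % K) % K            ≡⟨ %-distribˡ-+ 1 (x % K) K ⟩
  (1 % K + x % K % K) % K    ≡⟨ cong (λ y → (1 % K + y) % K) (m%n%n≡m%n x K) ⟩
  (1 % K + x % K) % K        ≡⟨ sym (%-distribˡ-+ 1 x K) ⟩
  suc x % K                  ∎)
  where
  open ≡-Reasoning
  K = suc k

module InducedCycleWalk {G : SimpleGraph} {k : ℕ} (cycle : InducedCycle G (4 + k)) where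
  open InducedCycle cycle

  K : ℕ
  K = 4 + k

  walk : ℕ → Fin (n G)
  walk x = c (x mod K)

  walk-periodic : ∀ x → walk (K + x) ≡ walk x
  walk-periodic x = cong c (mod-periodic x)

  walk-injective-< : ∀ {x y} → x < K → y < K → walk x ≡ walk y → x ≡ y
  walk-injective-< x<K y<K eq = mod-injective-< x<K y<K (c-inj eq)

  walk-adjacent : ∀ x → Adj G (walk x) (walk (suc x))
  walk-adjacent x = Equivalence.from (c-adj (x mod K) (suc x mod K) distinct) (inj₁ (sym (next-mod x)))
    where
    distinct : x mod K ≢ suc x mod K
    distinct eq = mod-shift-≢ x (s≤s z≤n) (s≤s (s≤s z≤n)) (sym eq)

  walk-adjacent⇒mod-≢ : ∀ {x y} → Adj G (walk x) (walk y) → x mod K ≢ y mod K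
  walk-adjacent⇒mod-≢ {x} adj eq = irrefl G (walk x) (subst (λ i → Adj G (walk x) (c i)) (sym eq) adj)

  walk-consecutive : ∀ {x y} → Adj G (walk x) (walk y) → y mod K ≡ suc x mod K ⊎ x mod K ≡ suc y mod K
  walk-consecutive {x} {y} adj with Equivalence.to (c-adj (x mod K) (y mod K) (walk-adjacent⇒mod-≢ {x} {y} adj)) adj
  ... | inj₁ eq = inj₁ (trans eq (next-mod x))
  ... | inj₂ eq = inj₂ (trans eq (next-mod y))

  walk-skip-distinct : ∀ x → walk x ≢ walk (2 + x)
  walk-skip-distinct x eq = mod-shift-≢ x (s≤s z≤n) (s≤s (s≤s (s≤s z≤n))) (sym (c-inj eq))

  walk-skip-nonadjacent : ∀ x → ¬ Adj G (walk x) (walk (2 + x))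
  walk-skip-nonadjacent x adj with walk-consecutive {x} {2 + x} adj
  ... | inj₁ eq = mod-shift-≢ (suc x) (s≤s z≤n) (s≤s (s≤s z≤n)) eq
  ... | inj₂ eq = mod-shift-≢ x (s≤s z≤n) (s≤s (s≤s (s≤s (s≤s z≤n)))) (sym eq)

  walk-adjacent-parity : parity K ≡ 0ℙ → ∀ x y → Adj G (walk x) (walk y) → parity x ≢ parity y
  walk-adjacent-parity even x y adj same with walk-consecutive {x} {y} adj
  ... | inj₁ eq = parity-suc-≢ x (trans (sym (mod-parity even y (suc x) eq)) (sym same))
  ... | inj₂ eq = parity-suc-≢ y (trans (sym (mod-parity even x (suc y) eq)) same)

module ConflictWalk {D : Multidigraph} (C : ℕ → Fin (nE D))
  (adjacent : ∀ x → TCAdj D (C x) (C (suc x)))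
  (skip-distinct : ∀ x → C x ≢ C (2 + x))
  (skip-nonadjacent : ∀ x → ¬ TCAdj D (C x) (C (2 + x))) where

  Periodic : ℕ → Set
  Periodic p = ∀ x → C (p + x) ≡ C x

  SameTarget : ℕ → Set
  SameTarget x = t D (C x) ≡ t D (C (suc x))

  Reversed : ℕ → Set
  Reversed x = s D (C x) ≡ t D (C (suc x)) × t D (C x) ≡ s D (C (suc x))

  sameTarget⊎reversed : ∀ x → SameTarget x ⊎ Reversed x
  sameTarget⊎reversed x with proj₂ (adjacent x)
  ... | inj₁ same = inj₁ same
  ... | inj₂ (inj₁ (_ , same)) = inj₁ same
  ... | inj₂ (inj₂ reversed) = inj₂ reversed

  ¬sameTarget-twice : ∀ {x} → SameTarget x → ¬ SameTarget (suc x)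
  ¬sameTarget-twice {x} p q = skip-nonadjacent x (skip-distinct x , inj₁ (trans p q))

  ¬reversed-twice : ∀ {x} → Reversed x → ¬ Reversed (suc x)
  ¬reversed-twice {x} (p₁ , p₂) (q₁ , q₂) =
    skip-nonadjacent x (skip-distinct x , inj₂ (inj₁ (trans p₁ q₂ , trans p₂ q₁)))

  sameTarget⇒reversed : ∀ {x} → SameTarget x → Reversed (suc x)
  sameTarget⇒reversed {x} p with sameTarget⊎reversed (suc x)
  ... | inj₁ q = ⊥-elim (¬sameTarget-twice p q)
  ... | inj₂ q = q

  reversed⇒sameTarget : ∀ {x} → Reversed x → SameTarget (suc x)
  reversed⇒sameTarget {x} p with sameTarget⊎reversed (suc x)
  ... | inj₁ q = q
  ... | inj₂ q = ⊥-elim (¬reversed-twice p q)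

  sameTarget-*2+ : ∀ m {x} → SameTarget x → SameTarget (m * 2 + x)
  sameTarget-*2+ zero p = p
  sameTarget-*2+ (suc m) p = reversed⇒sameTarget (sameTarget⇒reversed (sameTarget-*2+ m p))

  sameTarget-periodic : ∀ {p} → Periodic p → ∀ {x} → SameTarget x → SameTarget (p + x)
  sameTarget-periodic {p} periodic {x} same = begin
    t D (C (p + x))       ≡⟨ cong (t D) (periodic x) ⟩
    t D (C x)             ≡⟨ same ⟩
    t D (C (suc x))       ≡⟨ cong (t D) (sym (periodic (suc x))) ⟩
    t D (C (p + suc x))   ≡⟨ cong (λ y → t D (C y)) (+-suc p x) ⟩
    t D (C (suc (p + x))) ∎
    where open ≡-Reasoning

  sameTarget-start : ∃[ r ] (r ≤ 1 × SameTarget r)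
  sameTarget-start with sameTarget⊎reversed 0
  ... | inj₁ p = 0 , z≤n , p
  ... | inj₂ p = 1 , s≤s z≤n , reversed⇒sameTarget p

  r : ℕ
  r = proj₁ sameTarget-start

  r≤1 : r ≤ 1
  r≤1 = proj₁ (proj₂ sameTarget-start)

  sameTarget-even : ∀ j → SameTarget (j * 2 + r)
  sameTarget-even j = sameTarget-*2+ j (proj₂ (proj₂ sameTarget-start))

  reversed-odd : ∀ j → Reversed (suc (j * 2 + r))
  reversed-odd j = sameTarget⇒reversed (sameTarget-even j)

  ¬odd-period : ∀ m → ¬ Periodic (suc (m * 2))
  ¬odd-period m periodic = ¬sameTarget-twice (sameTarget-even m) (sameTarget-periodic periodic (sameTarget-even 0))

  hub : ℕ → Fin (nV D)
  hub j = t D (C (j * 2 + r))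

  backward-source : ∀ j → s D (C (suc (j * 2 + r))) ≡ hub (suc j)
  backward-source j = proj₁ (reversed-odd j)

  backward-target : ∀ j → t D (C (suc (j * 2 + r))) ≡ hub j
  backward-target j = sym (sameTarget-even j)

  forward-source : ∀ j → s D (C (suc j * 2 + r)) ≡ hub j
  forward-source j = trans (sym (proj₂ (reversed-odd j))) (backward-target j)

  hub-periodic : ∀ {M} → Periodic (M * 2) → ∀ j → hub (M + j) ≡ hub j
  hub-periodic {M} periodic j = cong (t D) (trans (cong C index) (periodic (j * 2 + r)))
    where
    index : (M + j) * 2 + r ≡ M * 2 + (j * 2 + r)
    index = trans (cong (_+ r) (*-distribʳ-+ 2 M j)) (+-assoc (M * 2) (j * 2) r)

  ¬period-4 : ¬ Periodic 4
  ¬period-4 periodic = skip-nonadjacent (1 + r) (skip-distinct (1 + r) , inj₂ (inj₂ (source≡target , target≡source)))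
    where
    source≡target : s D (C (1 + r)) ≡ t D (C (3 + r))
    source≡target = trans (backward-source 0) (sym (backward-target 1))
    target≡source : t D (C (1 + r)) ≡ s D (C (3 + r))
    target≡source = trans (backward-target 0) (trans (sym (hub-periodic {2} periodic 0)) (sym (backward-source 1)))

  directedCycle : ∀ m → Periodic (suc m * 2)
                → (∀ {x y} → x < suc m * 2 → y < suc m * 2 → C x ≡ C y → x ≡ y)
                → (∀ x y → TCAdj D (C x) (C y) → parity x ≢ parity y)
                → DirectedCycle D (suc m)
  directedCycle m periodic injective-< adjacent-parity = record
    { v     = λ i → hub (toℕ i)
    ; v-inj = λ eq → toℕ-injective (hub-injective (toℕ<n _) (toℕ<n _) eq)
    ; e     = λ i → C (suc (toℕ i) * 2 + r)
    ; e-src = λ i → forward-source (toℕ i)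
    ; e-tgt = hub-next
    }
    where
    open ≡-Reasoning
    M = suc m

    hub-next : ∀ i → hub (suc (toℕ i)) ≡ hub (toℕ (next i))
    hub-next i = begin
      hub (suc (toℕ i))      ≡⟨ sym (periodic-% hub {M} (hub-periodic {M} periodic) (suc (toℕ i))) ⟩
      hub (suc (toℕ i) % M)  ≡⟨ cong hub (sym (toℕ-fromℕ< (m%n<n (suc (toℕ i)) M))) ⟩
      hub (toℕ (next i))     ∎

    hub-injective : ∀ {i j} → i < M → j < M → hub i ≡ hub j → i ≡ j
    hub-injective {i} {j} i<M j<M eq = decidable-stable (i ≟ j) λ i≢j →
      adjacent-parity (i * 2 + r) (j * 2 + r) (distinct i≢j , inj₁ eq) (trans (parity-*2+ i r) (sym (parity-*2+ j r)))
      where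
      distinct : i ≢ j → C (i * 2 + r) ≢ C (j * 2 + r)
      distinct i≢j eq = i≢j (*2+-injective r (injective-< (*2+-< r≤1 i<M) (*2+-< r≤1 j<M) eq))

module ConflictCycle {D : Multidigraph} {k : ℕ} (cycle : InducedCycle (treeConflictGraph D) (4 + k)) where
  open InducedCycleWalk cycle public
  open ConflictWalk {D} walk walk-adjacent walk-skip-distinct walk-skip-nonadjacent public

¬odd-induced-cycle : ∀ {D} m → ¬ InducedCycle (treeConflictGraph D) (5 + m * 2)
¬odd-induced-cycle m cycle = ¬odd-period (2 + m) walk-periodic
  where open ConflictCycle cycle

¬induced-4-cycle : ∀ {D} → ¬ InducedCycle (treeConflictGraph D) 4
¬induced-4-cycle cycle = ¬period-4 walk-periodic
  where open ConflictCycle cycle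

¬long-even-induced-cycle : ∀ {D} → TwoAcyclic D → ∀ m → ¬ InducedCycle (treeConflictGraph D) (6 + m * 2)
¬long-even-induced-cycle 2-acyclic m cycle =
  2-acyclic (3 + m) (s≤s (s≤s (s≤s z≤n)))
    (directedCycle (2 + m) walk-periodic walk-injective-< (walk-adjacent-parity (parity-*2 (3 + m))))
  where open ConflictCycle cycle

theorem4p3 : (D : Multidigraph) → TwoAcyclic D → Chordal (treeConflictGraph D)
theorem4p3 D 2-acyclic _ (s≤s (s≤s (s≤s (s≤s {n = k} z≤n)))) with even-or-odd k
... | m , inj₂ refl = ¬odd-induced-cycle m
... | zero , inj₁ refl = ¬induced-4-cycle
... | suc m , inj₁ refl = ¬long-even-induced-cycle 2-acyclic m
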